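{- Let $k\in\mathbb{Z}$ and $n\in\mathbb{Z}^+$. Then $\chi_{n,k}(R_3)=3$ if $\gcd(7,n)\mid k$ and $\chi_{n,k}(R_3)=4$ otherwise; $\chi_{n,k}(R_4)=2$ if $\gcd(5,n)\mid k$ and $\chi_{n,k}(R_4)=3$ otherwise; $\chi_{n,k}(R_6)=2$ if $\gcd(8,n)\mid 2k$ and $\chi_{n,k}(R_6)=3$ otherwise.
   Context: $R_3$, $R_4$, $R_6$ denote the infinite graphs formed by the vertices and edges of the regular tilings of the plane by equilateral triangles (the $6$-regular triangular lattice), squares (the $4$-regular square grid $\mathbb{Z}^2$), and regular hexagons (the $3$-regular hexagonal lattice), respectively. For a graph $G=(V,E)$, a labeling $\ell:V\to\mathbb{Z}$ is proper if adjacent vertices get distinct labels, its order is the size of its image, and it is a closed coloring with remainder $k\bmod n$ if $\sum_{w\in N[v]}\ell(w)\equiv k\pmod n$ for every $v$, where $N[v]$ is the closed neighborhood of $v$. $\chi_{n,k}(G)$ is the minimum order of a proper closed coloring with remainder $k\bmod n$. -}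

module Defs where

open import Data.Nat using (ℕ; _≤_; zero; suc)
open import Data.Integer.DivMod using (_%ℕ_)
open import Data.Integer using (ℤ; +_; _+_; _-_)
open import Data.Integer.Divisibility using (_∣_)
open import Data.Fin using (Fin)
open import Data.List using (List; []; _∷_; map; foldr)
open import Data.List.Membership.Propositional using (_∈_)
open import Data.Product using (_×_; _,_; ∃; ∃-syntax; Σ)
open import Relation.Binary.PropositionalEquality using (_≡_; _≢_)
open import Function.Definitions using (Injective)

record Graph : Set₁ where
  field
    V    : Set
    nbrs : V → List V

open Graph public

Pt : Set
Pt = ℤ × ℤ

R4 : Graph
R4 = record
  { V = Pt
  ; nbrs = λ { (x , y) → (x + + 1 , y) ∷ (x - + 1 , y) ∷ (x , y + + 1) ∷ (x , y - + 1) ∷ [] } }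

-- R₃ : triangular lattice, 6-regular (square grid plus the diagonals
-- (x,y) ~ (x+1,y-1)).
R3 : Graph
R3 = record
  { V = Pt
  ; nbrs = λ { (x , y) →
      (x + + 1 , y) ∷ (x - + 1 , y) ∷ (x , y + + 1) ∷ (x , y - + 1)
      ∷ (x + + 1 , y - + 1) ∷ (x - + 1 , y + + 1) ∷ [] } }

-- R₆ : hexagonal (honeycomb) lattice, 3-regular, in brick-wall form:
-- horizontal edges (x,y) ~ (x±1,y); the vertical edge goes up from
-- (x,y) when x+y is even and down when x+y is odd.
vert : ℤ → ℤ → Pt
vert x y with (x + y) %ℕ 2
... | zero  = (x , y + + 1)
... | suc _ = (x , y - + 1)

R6 : Graph
R6 = record
  { V = Pt
  ; nbrs = λ { (x , y) → (x + + 1 , y) ∷ (x - + 1 , y) ∷ vert x y ∷ [] } }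

module _ (G : Graph) where

  closedSum : (V G → ℤ) → V G → ℤ
  closedSum ℓ v = ℓ v + foldr _+_ (+ 0) (map ℓ (nbrs G v))

  Proper : (V G → ℤ) → Set
  Proper ℓ = ∀ u v → v ∈ nbrs G u → ℓ u ≢ ℓ v

  Closed : ℕ → ℤ → (V G → ℤ) → Set
  Closed n k ℓ = ∀ v → (+ n) ∣ (closedSum ℓ v - k)

  -- the image of ℓ has exactly m elements: it is enumerated without
  -- repetition by some f : Fin m → ℤ
  HasOrder : (V G → ℤ) → ℕ → Set
  HasOrder ℓ m = Σ (Fin m → ℤ) λ f →
    Injective _≡_ _≡_ f × (∀ v → ∃[ i ] ℓ v ≡ f i) × (∀ i → ∃[ v ] ℓ v ≡ f i)

  ProperClosed : ℕ → ℤ → (V G → ℤ) → Set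
  ProperClosed n k ℓ = Proper ℓ × Closed n k ℓ

  ChiEq : ℕ → ℤ → ℕ → Set
  ChiEq n k m =
    (∃[ ℓ ] (ProperClosed n k ℓ × HasOrder ℓ m)) ×
    (∀ ℓ j → ProperClosed n k ℓ → HasOrder ℓ j → m ≤ j)

-- A labelling that factors through residues of the coordinates can be checked
-- on finitely many residue classes. Each lattice has a proper colouring p by a
-- residue of a linear form (q = 3 colours for R₃, 2 for R₄ and R₆) and a
-- perfect code D, a set meeting every closed neighbourhood exactly once, cut out
-- by another linear residue. If |N[v]|·a ≡ k (mod n) is solvable, that is
-- gcd(|N[v]|, n) ∣ k, the labels a + n·p(v) form a proper closed labelling of
-- order q; on R₆, whose closed sums are 4a + e and 4a + 3e, any step e ≠ 0 with
-- 4a + e ≡ k and 2e ≡ 0 will do, and such a, e exist once gcd(8, n) ∣ 2k.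
-- Otherwise the labels k on D and n·p(v) elsewhere have order q + 1.
-- Conversely q labels are needed because of an edge or a triangle, and q labels
-- are forced locally: on R₄ and R₆ all neighbours of a vertex carry the other
-- label, on R₃ every triangle carries all three. The closed sums at two or three
-- adjacent vertices are then A + dB and B + dA, or A + 3(B + C) and its
-- permutations, and an integer combination of these congruences gives
-- gcd(5, n) ∣ k, gcd(8, n) ∣ 2k and gcd(7, n) ∣ k.

module Submission where

open import Defs
open import Data.Nat using (ℕ; _<_)
open import Data.Nat.GCD using (gcd)
open import Data.Integer using (ℤ; +_; _*_)
open import Data.Integer.Divisibility using (_∣_)
open import Data.Product using (_×_)
open import Relation.Nullary using (¬_)

open import Data.Fin as Fin using (Fin; zero; suc; toℕ; fromℕ; inject₁; lower₁)
import Data.Fin.Properties as Fin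
open import Data.Integer as ℤ using (-[1+_]; _+_; _-_; -_; -1ℤ)
import Data.Integer.Properties as ℤ
open import Algebra.Properties.AbelianGroup ℤ.+-0-abelianGroup using (∙-cancelˡ)
open import Data.Integer.Divisibility.Signed as Signed
  using (divides; ∣ᵤ⇒∣; ∣⇒∣ᵤ; ∣m∣n⇒∣m+n; ∣n⇒∣m*n; ∣m⇒∣m*n)
  renaming (_∣_ to _∣ˢ_)
open import Data.Integer.Tactic.RingSolver using (solve-∀)
open import Data.List as List using (List; []; _∷_; map; foldr; length; filter)
import Data.List.Properties as List
open import Data.List.Membership.Propositional using (_∈_)
open import Data.List.Membership.Propositional.Properties using (∈-map⁺)
open import Data.Product.Properties using (≡-dec)
open import Data.List.Membership.DecPropositional (≡-dec ℤ._≟_ ℤ._≟_) using (_∈?_)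
open import Data.List.Relation.Binary.Pointwise using (Pointwise-≡⇒≡; []; _∷_)
open import Data.List.Relation.Unary.All as All using (All; []; _∷_)
open import Data.List.Relation.Unary.Any using (here; there)
open import Data.Nat as ℕ using (zero; suc; _≤_)
import Data.Nat.DivMod as ℕ
open import Data.Nat.GCD using (gcd-GCD; gcd[m,n]∣m; gcd[m,n]∣n; module Bézout)
open import Data.Nat.GeneralisedArithmetic using (iterate)
open import Data.Nat.ListAction using () renaming (sum to sumℕ)
import Data.Nat.Properties as ℕ
open import Data.Product using (_,_; proj₁; proj₂; ∃-syntax)
open import Data.Sum using (_⊎_; inj₁; inj₂)
open import Data.Vec as Vec using (Vec; []; _∷_; lookup)
import Data.Vec.Properties as Vec
open import Data.Vec.Relation.Unary.All using ([]; _∷_)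
open import Data.Vec.Relation.Unary.AllPairs using ([]; _∷_)
open import Data.Vec.Relation.Unary.Unique.Propositional using (Unique)
open import Data.Vec.Relation.Unary.Unique.Propositional.Properties using (lookup-injective)
open import Function using (_∘_)
open import Function.Definitions using (Injective)
open import Relation.Binary.PropositionalEquality
open import Relation.Nullary using (Dec; yes; no; contradiction; ¬?)
open import Relation.Nullary.Decidable using (True; toWitness; _⊎-dec_)

sumℤ : List ℤ → ℤ
sumℤ = foldr _+_ (+ 0)

gcd∣combination : ∀ c n x {m z} → + n ∣ˢ m → z ≡ + c * x + m → + gcd c n ∣ z
gcd∣combination c n x n∣m refl =
  ∣⇒∣ᵤ (∣m∣n⇒∣m+n (∣m⇒∣m*n x (∣ᵤ⇒∣ {+ gcd c n} {+ c} (gcd[m,n]∣m c n)))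
                  (Signed.∣-trans (∣ᵤ⇒∣ {+ gcd c n} {+ n} (gcd[m,n]∣n c n)) n∣m))

gcd∣multiple : ∀ c n t → + gcd c n ∣ t * + n
gcd∣multiple c n t = gcd∣combination c n (+ 0) {t * + n} (∣n⇒∣m*n t Signed.∣-refl)
  (trans (sym (ℤ.+-identityˡ (t * + n))) (cong (_+ t * + n) (sym (ℤ.*-zeroʳ (+ c)))))

not-multiple : ∀ c n {k} → ¬ (+ gcd c n ∣ k) → ∀ t → k ≢ t * + n
not-multiple c n ¬g∣k t refl = ¬g∣k (gcd∣multiple c n t)

private
  cast-identity : ∀ d a b p q → d ℕ.+ a ℕ.* b ≡ p ℕ.* q → + d + + a * + b ≡ + p * + q
  cast-identity d a b p q eq = begin
    + d + + a * + b    ≡⟨ cong (_+_ (+ d)) (ℤ.pos-* a b) ⟨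
    + d + + (a ℕ.* b)  ≡⟨ ℤ.pos-+ d (a ℕ.* b) ⟨
    + (d ℕ.+ a ℕ.* b)  ≡⟨ cong +_ eq ⟩
    + (p ℕ.* q)        ≡⟨ ℤ.pos-* p q ⟩
    + p * + q          ∎
    where open ≡-Reasoning

bézout-mod : ∀ c n → ∃[ u ] + n ∣ˢ + c * u - + gcd c n
bézout-mod c n with Bézout.identity (gcd-GCD c n)
... | Bézout.+- x y eq = + x , divides (+ y) (begin
  + c * + x - + gcd c n              ≡⟨ cong (_- + gcd c n) (ℤ.*-comm (+ c) (+ x)) ⟩
  + x * + c - + gcd c n              ≡⟨ cong (_- + gcd c n) (cast-identity (gcd c n) y n x c eq) ⟨
  + gcd c n + + y * + n - + gcd c n  ≡⟨ x+y-x≡y (+ gcd c n) (+ y * + n) ⟩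
  + y * + n                          ∎)
  where
  open ≡-Reasoning
  x+y-x≡y : ∀ x y → x + y - x ≡ y
  x+y-x≡y = solve-∀
... | Bézout.-+ x y eq = - + x , divides (- + y) (begin
  + c * - + x - + gcd c n    ≡⟨ rearrange (+ c) (+ x) (+ gcd c n) ⟩
  - (+ gcd c n + + x * + c)  ≡⟨ cong -_ (cast-identity (gcd c n) x c y n eq) ⟩
  - (+ y * + n)              ≡⟨ ℤ.neg-distribˡ-* (+ y) (+ n) ⟩
  - + y * + n                ∎)
  where
  open ≡-Reasoning
  rearrange : ∀ c x d → c * - x - d ≡ - (d + x * c)
  rearrange = solve-∀

linear-congruence : ∀ c n {k} → + gcd c n ∣ k → ∃[ a ] + n ∣ˢ + c * a - k
linear-congruence c n {k} g∣k with ∣ᵤ⇒∣ {+ gcd c n} {k} g∣k | bézout-mod c n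
... | divides q refl | u , n∣cu-g =
  q * u , subst (+ n ∣ˢ_) (distribute q (+ c) u (+ gcd c n)) (∣n⇒∣m*n q n∣cu-g)
  where
  distribute : ∀ q c u d → q * (c * u - d) ≡ c * (q * u) - q * d
  distribute = solve-∀

+n≢0 : ∀ {n} → 0 < n → + n ≢ + 0
+n≢0 n>0 = ℕ.<⇒≢ n>0 ∘ sym ∘ ℤ.+-injective

∣-add-multiple : ∀ {n x k} t → + n ∣ˢ x - k → + n ∣ˢ x + t * + n - k
∣-add-multiple {n} {x} {k} t n∣x-k =
  subst (+ n ∣ˢ_) (swap x k (t * + n)) (∣m∣n⇒∣m+n n∣x-k (∣n⇒∣m*n t Signed.∣-refl))
  where
  swap : ∀ x k y → x - k + y ≡ x + y - k
  swap = solve-∀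

sum-const : ∀ {A : Set} (f : A → ℤ) {c} xs → All (λ x → f x ≡ c) xs →
            sumℤ (map f xs) ≡ + length xs * c
sum-const f []       []             = refl
sum-const f {c} (x ∷ xs) (fx≡c ∷ fxs≡c) = begin
  f x + sumℤ (map f xs)        ≡⟨ cong₂ _+_ fx≡c (sum-const f xs fxs≡c) ⟩
  c + + length xs * c          ≡⟨ ℤ.suc-* (+ length xs) c ⟨
  + suc (length xs) * c        ∎
  where open ≡-Reasoning

-- The order of a labelling

module _ {G : Graph} {ℓ : V G → ℤ} where

  distinct-labels⇒≤order : ∀ {c j} → HasOrder G ℓ j → (w : Fin c → V G) →
                           Injective _≡_ _≡_ (ℓ ∘ w) → c ≤ j
  distinct-labels⇒≤order (f , _ , index , _) w inj = Fin.injective⇒≤ index-injective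
    where
    index-injective : Injective _≡_ _≡_ (λ i → proj₁ (index (w i)))
    index-injective {a} {b} eq = inj (begin
      ℓ (w a)                  ≡⟨ proj₂ (index (w a)) ⟩
      f (proj₁ (index (w a)))  ≡⟨ cong f eq ⟩
      f (proj₁ (index (w b)))  ≡⟨ proj₂ (index (w b)) ⟨
      ℓ (w b)                  ∎)
      where open ≡-Reasoning

  label-among : ∀ {c} → HasOrder G ℓ c → (w : Fin c → V G) → Injective _≡_ _≡_ (ℓ ∘ w) →
                ∀ v → ∃[ i ] ℓ v ≡ ℓ (w i)
  label-among {c} order w inj v with Fin.any? (λ i → ℓ v ℤ.≟ ℓ (w i))
  ... | yes found = found
  ... | no new    = contradiction (distinct-labels⇒≤order order w⁺ inj⁺) ℕ.1+n≰n
    where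
    w⁺ : Fin (suc c) → V G
    w⁺ zero    = v
    w⁺ (suc i) = w i
    inj⁺ : Injective _≡_ _≡_ (ℓ ∘ w⁺)
    inj⁺ {zero}  {zero}  _  = refl
    inj⁺ {zero}  {suc j} eq = contradiction (j , eq) new
    inj⁺ {suc i} {zero}  eq = contradiction (i , sym eq) new
    inj⁺ {suc i} {suc j} eq = cong suc (inj eq)

  unique-labels : ∀ {c} (ws : Vec (V G) c) → Unique (Vec.map ℓ ws) →
                  Injective _≡_ _≡_ (ℓ ∘ lookup ws)
  unique-labels ws unique {i} {j} eq = lookup-injective unique i j (begin
    lookup (Vec.map ℓ ws) i  ≡⟨ Vec.lookup-map i ℓ ws ⟩
    ℓ (lookup ws i)          ≡⟨ eq ⟩
    ℓ (lookup ws j)          ≡⟨ Vec.lookup-map j ℓ ws ⟨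
    lookup (Vec.map ℓ ws) j  ∎)
    where open ≡-Reasoning

  edge⇒2≤order : Proper G ℓ → ∀ {u v j} → v ∈ nbrs G u → HasOrder G ℓ j → 2 ≤ j
  edge⇒2≤order proper {u} {v} uv order =
    distinct-labels⇒≤order order _ (unique-labels (u ∷ v ∷ []) ((proper u v uv ∷ []) ∷ [] ∷ []))

  triangle⇒3≤order : Proper G ℓ → ∀ {u v w j} → v ∈ nbrs G u → w ∈ nbrs G u → w ∈ nbrs G v →
                     HasOrder G ℓ j → 3 ≤ j
  triangle⇒3≤order proper {u} {v} {w} uv uw vw order = distinct-labels⇒≤order order _
    (unique-labels (u ∷ v ∷ w ∷ [])
      ((proper u v uv ∷ proper u w uw ∷ []) ∷ (proper v w vw ∷ []) ∷ [] ∷ []))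

  order-2-neighbours : Proper G ℓ → HasOrder G ℓ 2 →
                       ∀ {u v w} → v ∈ nbrs G u → w ∈ nbrs G u → ℓ w ≡ ℓ v
  order-2-neighbours proper order {u} {v} {w} uv uw
    with label-among order _ (unique-labels (u ∷ v ∷ []) ((proper u v uv ∷ []) ∷ [] ∷ [])) w
  ... | zero     , wu = contradiction (sym wu) (proper u w uw)
  ... | suc zero , wv = wv

  closedSum-order-2 : Proper G ℓ → HasOrder G ℓ 2 → ∀ {u v} → v ∈ nbrs G u →
                      closedSum G ℓ u ≡ ℓ u + + length (nbrs G u) * ℓ v
  closedSum-order-2 proper order {u} uv =
    cong (_+_ (ℓ u)) (sum-const ℓ (nbrs G u) (All.tabulate (order-2-neighbours proper order uv)))

order-step : ∀ {G ℓ c j} → c ≤ j → ¬ HasOrder G ℓ c → HasOrder G ℓ j → suc c ≤ j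
order-step c≤j ¬order-c order = ℕ.≤∧≢⇒< c≤j (λ { refl → ¬order-c order })

hasOrder-by-witnesses : ∀ {G c} {f : Fin c → ℤ} (code : V G → Fin c) → Injective _≡_ _≡_ f →
                        (w : Vec (V G) c) → (∀ d → code (lookup w d) ≡ d) → HasOrder G (f ∘ code) c
hasOrder-by-witnesses {f = f} code inj w hit =
  f , inj , (λ v → code v , refl) , (λ d → lookup w d , cong f (hit d))

-- Residues as orbits of a rotation

-- orbit z is z modulo suc m, built so that a shift of z by d is visibly d
-- rotations; %ℕ2≡orbit relates it to the library's _%ℕ_ used in the definition of R6.

rotate : ∀ {m} → Fin (suc m) → Fin (suc m)
rotate {m} i with m ℕ.≟ toℕ i
... | yes _   = zero
... | no m≢i  = suc (lower₁ i m≢i)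

rotate⁻¹ : ∀ {m} → Fin (suc m) → Fin (suc m)
rotate⁻¹ zero    = fromℕ _
rotate⁻¹ (suc i) = inject₁ i

rotate⁻¹∘rotate : ∀ {m} (i : Fin (suc m)) → rotate⁻¹ (rotate i) ≡ i
rotate⁻¹∘rotate {m} i with m ℕ.≟ toℕ i
... | yes m≡i = Fin.toℕ-injective (trans (Fin.toℕ-fromℕ m) m≡i)
... | no m≢i  = Fin.inject₁-lower₁ i m≢i

rotate∘rotate⁻¹ : ∀ {m} (i : Fin (suc m)) → rotate (rotate⁻¹ i) ≡ i
rotate∘rotate⁻¹ {m} zero with m ℕ.≟ toℕ (fromℕ m)
... | yes _   = refl
... | no m≢m  = contradiction (sym (Fin.toℕ-fromℕ m)) m≢m
rotate∘rotate⁻¹ {m} (suc i) with m ℕ.≟ toℕ (inject₁ i)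
... | yes m≡i = contradiction m≡i (Fin.toℕ-inject₁-≢ i)
... | no m≢i  = cong suc (Fin.lower₁-inject₁′ i m≢i)

_↻_ _↺_ : ∀ {m} → Fin (suc m) → ℕ → Fin (suc m)
i ↻ d = iterate rotate i d
i ↺ d = iterate rotate⁻¹ i d

orbit : ∀ {m} → ℤ → Fin (suc m)
orbit (+ zero)      = zero
orbit (+ suc n)     = rotate (orbit (+ n))
orbit -[1+ zero ]   = rotate⁻¹ zero
orbit -[1+ suc n ]  = rotate⁻¹ (orbit -[1+ n ])

module _ {m : ℕ} where

  orbit-suc : ∀ z → orbit {m} (z + + 1) ≡ rotate (orbit z)
  orbit-suc (+ n)           = cong (orbit ∘ +_) (ℕ.+-comm n 1)
  orbit-suc -[1+ zero ]     = sym (rotate∘rotate⁻¹ zero)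
  orbit-suc -[1+ suc n ]    = sym (rotate∘rotate⁻¹ (orbit -[1+ n ]))

  orbit-pred : ∀ z → orbit {m} (z - + 1) ≡ rotate⁻¹ (orbit z)
  orbit-pred z = begin
    orbit (z - + 1)                        ≡⟨ rotate⁻¹∘rotate (orbit (z - + 1)) ⟨
    rotate⁻¹ (rotate (orbit (z - + 1)))    ≡⟨ cong rotate⁻¹ (orbit-suc (z - + 1)) ⟨
    rotate⁻¹ (orbit (z - + 1 + + 1))       ≡⟨ cong (rotate⁻¹ ∘ orbit) (z-1+1≡z z) ⟩
    rotate⁻¹ (orbit z)                     ∎
    where
    open ≡-Reasoning
    z-1+1≡z : ∀ z → z - + 1 + + 1 ≡ z
    z-1+1≡z = solve-∀

  orbit-+ : ∀ z d → orbit {m} (z + + d) ≡ orbit z ↻ d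
  orbit-+ z zero    = cong orbit (ℤ.+-identityʳ z)
  orbit-+ z (suc d) = begin
    orbit (z + (+ 1 + + d))             ≡⟨ cong orbit (ℤ.+-assoc z (+ 1) (+ d)) ⟨
    orbit (z + + 1 + + d)               ≡⟨ orbit-+ (z + + 1) d ⟩
    iterate rotate (orbit (z + + 1)) d  ≡⟨ cong (λ i → iterate rotate i d) (orbit-suc z) ⟩
    iterate rotate (rotate (orbit z)) d ∎
    where open ≡-Reasoning

  orbit-∸ : ∀ z d → orbit {m} (z - + d) ≡ orbit z ↺ d
  orbit-∸ z zero    = cong orbit (ℤ.+-identityʳ z)
  orbit-∸ z (suc d) = begin
    orbit (z - (+ 1 + + d))               ≡⟨ cong orbit (split z (+ d)) ⟩
    orbit (z - + 1 - + d)                 ≡⟨ orbit-∸ (z - + 1) d ⟩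
    iterate rotate⁻¹ (orbit (z - + 1)) d  ≡⟨ cong (λ i → iterate rotate⁻¹ i d) (orbit-pred z) ⟩
    iterate rotate⁻¹ (rotate⁻¹ (orbit z)) d ∎
    where
    open ≡-Reasoning
    split : ∀ z d → z - (+ 1 + d) ≡ z - + 1 - d
    split = solve-∀

private
  rotate-involutive : (i : Fin 2) → rotate (rotate i) ≡ i
  rotate-involutive zero       = refl
  rotate-involutive (suc zero) = refl

  rotate⁻¹-involutive : (i : Fin 2) → rotate⁻¹ (rotate⁻¹ i) ≡ i
  rotate⁻¹-involutive zero       = refl
  rotate⁻¹-involutive (suc zero) = refl

  %2-suc-suc : ∀ n → suc (suc n) ℕ.% 2 ≡ n ℕ.% 2
  %2-suc-suc n = trans (cong (ℕ._% 2) (ℕ.+-comm 2 n)) (ℕ.[m+n]%n≡m%n n 2)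

  %2≡orbit⁺ : ∀ n → n ℕ.% 2 ≡ toℕ (orbit {1} (+ n))
  %2≡orbit⁺ zero          = refl
  %2≡orbit⁺ (suc zero)    = refl
  %2≡orbit⁺ (suc (suc n)) = begin
    suc (suc n) ℕ.% 2                    ≡⟨ %2-suc-suc n ⟩
    n ℕ.% 2                              ≡⟨ %2≡orbit⁺ n ⟩
    toℕ (orbit (+ n))                    ≡⟨ cong toℕ (rotate-involutive (orbit (+ n))) ⟨
    toℕ (rotate (rotate (orbit (+ n))))  ∎
    where open ≡-Reasoning

  %2≡orbit⁻ : ∀ n → suc n ℕ.% 2 ≡ toℕ (orbit {1} -[1+ n ])
  %2≡orbit⁻ zero          = refl
  %2≡orbit⁻ (suc zero)    = refl
  %2≡orbit⁻ (suc (suc n)) = begin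
    suc (suc (suc n)) ℕ.% 2                     ≡⟨ %2-suc-suc (suc n) ⟩
    suc n ℕ.% 2                                 ≡⟨ %2≡orbit⁻ n ⟩
    toℕ (orbit -[1+ n ])                        ≡⟨ cong toℕ (rotate⁻¹-involutive (orbit -[1+ n ])) ⟨
    toℕ (rotate⁻¹ (rotate⁻¹ (orbit -[1+ n ])))  ∎
    where open ≡-Reasoning

%ℕ2≡orbit : ∀ z → z ℤ.%ℕ 2 ≡ toℕ (orbit {1} z)
%ℕ2≡orbit (+ n)     = %2≡orbit⁺ n
%ℕ2≡orbit -[1+ n ] with suc n ℕ.% 2 | %2≡orbit⁻ n
... | zero        | 0≡i = 0≡i
... | suc zero    | 1≡i = 1≡i
... | suc (suc _) | r≡i =
  contradiction (subst (ℕ._< 2) (sym r≡i) (Fin.toℕ<n _)) λ { (ℕ.s≤s (ℕ.s≤s ())) }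

multiple : ∀ {q} → ℤ → Fin q → ℤ
multiple e i = + toℕ i * e

progression : ∀ {q} → ℤ → ℤ → Fin q → ℤ
progression a e i = a + multiple e i

with-special : ∀ {q} → ℤ → ℤ → Fin (suc q) → ℤ
with-special k e zero    = k
with-special k e (suc i) = multiple e i

multiple-injective : ∀ {q e} → e ≢ + 0 → Injective _≡_ _≡_ (multiple {q} e)
multiple-injective {e = e} e≢0 {i} {j} eq =
  Fin.toℕ-injective (ℤ.+-injective (ℤ.*-cancelʳ-≡ (+ toℕ i) (+ toℕ j) e {{ℤ.≢-nonZero e≢0}} eq))

progression-injective : ∀ {q a e} → e ≢ + 0 → Injective _≡_ _≡_ (progression {q} a e)
progression-injective {a = a} e≢0 eq = multiple-injective e≢0 (∙-cancelˡ a _ _ eq)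

with-special-injective : ∀ {q k e} → e ≢ + 0 → (∀ i → k ≢ multiple e i) →
                         Injective _≡_ _≡_ (with-special {q} k e)
with-special-injective e≢0 k≢ {zero}  {zero}  _  = refl
with-special-injective e≢0 k≢ {zero}  {suc j} eq = contradiction eq (k≢ j)
with-special-injective e≢0 k≢ {suc i} {zero}  eq = contradiction (sym eq) (k≢ i)
with-special-injective e≢0 k≢ {suc i} {suc j} eq = cong suc (multiple-injective e≢0 eq)

sum-progression : ∀ {A : Set} {q} a e (col : A → Fin q) xs →
                  sumℤ (map (progression a e ∘ col) xs) ≡
                  + length xs * a + + sumℕ (map (toℕ ∘ col) xs) * e
sum-progression a e col []       = refl
sum-progression a e col (x ∷ xs) = begin
  a + + t * e + sumℤ (map (progression a e ∘ col) xs)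
    ≡⟨ cong (_+_ (a + + t * e)) (sum-progression a e col xs) ⟩
  a + + t * e + (+ L * a + + T * e)
    ≡⟨ regroup a e (+ t) (+ L) (+ T) ⟩
  (a + + L * a) + (+ t + + T) * e
    ≡⟨ cong₂ (λ u v → u + v * e) (ℤ.suc-* (+ L) a) (ℤ.pos-+ t T) ⟨
  + suc L * a + + (t ℕ.+ T) * e
    ∎
  where
  open ≡-Reasoning
  t L T : ℕ
  t = toℕ (col x)
  L = length xs
  T = sumℕ (map (toℕ ∘ col) xs)
  regroup : ∀ a e t L T → a + t * e + (L * a + T * e) ≡ (a + L * a) + (t + T) * e
  regroup = solve-∀

special-code : ∀ {q r} → Fin q × Fin (suc r) → Fin (suc q)
special-code (p , zero)  = zero
special-code (p , suc _) = suc p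

in-code? : ∀ {q r} (i : Fin q × Fin (suc r)) → Dec (proj₂ i ≡ zero)
in-code? i = proj₂ i Fin.≟ zero

sum-with-special : ∀ {q r n} k (cs : List (Fin q × Fin (suc r))) →
                   + n ∣ˢ sumℤ (map (with-special k (+ n) ∘ special-code) cs) - + length (filter in-code? cs) * k
sum-with-special k []                = divides (+ 0) refl
sum-with-special {n = n} k ((p , zero) ∷ cs) =
  subst (+ n ∣ˢ_) (trans (absorb k S (+ L * k)) (cong (λ z → k + S - z) (sym (ℤ.suc-* (+ L) k))))
        (sum-with-special k cs)
  where
  S : ℤ
  S = sumℤ (map (with-special k (+ n) ∘ special-code) cs)
  L : ℕ
  L = length (filter in-code? cs)
  absorb : ∀ k S X → S - X ≡ k + S - (k + X)
  absorb = solve-∀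
sum-with-special {n = n} k ((p , suc _) ∷ cs) =
  subst (+ n ∣ˢ_) (sym (ℤ.+-assoc (multiple (+ n) p) _ _))
        (∣m∣n⇒∣m+n (∣n⇒∣m*n (+ toℕ p) Signed.∣-refl) (sum-with-special k cs))

-- Periodic labellings

all-Fin : ∀ {c} {P : Fin c → Set} (P? : ∀ i → Dec (P i)) → {True (Fin.all? P?)} → ∀ i → P i
all-Fin P? {t} = toWitness t

all-classes : ∀ {q r} {P : Fin q × Fin r → Set} (P? : ∀ i → Dec (P i)) →
              {True (Fin.all? (λ p → Fin.all? (λ c → P? (p , c))))} → ∀ i → P i
all-classes P? {t} (p , c) = toWitness t p c

-- The neighbours of every vertex lie, in order, in the classes listed by nb, so
-- properties of a labelling that factors through class are decided on the
-- finitely many classes. In the lattices the first coordinate of a class is a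
-- proper colouring and the zero residues of the second form a perfect code.
record Cover (G : Graph) (q r : ℕ) : Set where
  field
    class      : V G → Fin q × Fin r
    nb         : Fin q × Fin r → List (Fin q × Fin r)
    class-nbrs : ∀ v → map class (nbrs G v) ≡ nb (class v)

module _ {G : Graph} {q r : ℕ} (cover : Cover G q r) where
  open Cover cover

  Separates : ∀ {c} → (Fin q × Fin r → Fin c) → Set
  Separates code = ∀ i → All (λ j → code i ≢ code j) (nb i)

  separates? : ∀ {c} (code : Fin q × Fin r → Fin c) → ∀ i → Dec (All (λ j → code i ≢ code j) (nb i))
  separates? code i = All.all? (λ j → ¬? (code i Fin.≟ code j)) (nb i)

  hits? : ∀ {c} (code : Fin q × Fin r → Fin c) (w : Vec (V G) c) →
          ∀ d → Dec (code (class (lookup w d)) ≡ d)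
  hits? code w d = code (class (lookup w d)) Fin.≟ d

  proper-via-cover : ∀ {c} {f : Fin c → ℤ} (code : Fin q × Fin r → Fin c) →
                     Injective _≡_ _≡_ f → Separates code → Proper G (f ∘ code ∘ class)
  proper-via-cover code inj separates u v uv =
    All.lookup (separates (class u)) (subst (class v ∈_) (class-nbrs u) (∈-map⁺ class uv)) ∘ inj

  closedSum-via-cover : (f : Fin q × Fin r → ℤ) → ∀ v →
                        closedSum G (f ∘ class) v ≡ sumℤ (map f (class v ∷ nb (class v)))
  closedSum-via-cover f v = cong (λ cs → f (class v) + sumℤ cs)
    (trans (List.map-∘ (nbrs G v)) (cong (map f) (class-nbrs v)))

  progression-labelling : ∀ {a e} → e ≢ + 0 → Separates proj₁ →
                          (w : Vec (V G) q) → (∀ d → proj₁ (class (lookup w d)) ≡ d) →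
                          Proper G (progression a e ∘ proj₁ ∘ class) ×
                          HasOrder G (progression a e ∘ proj₁ ∘ class) q
  progression-labelling {a} {e} e≢0 separates w hit =
    proper-via-cover proj₁ injective separates ,
    hasOrder-by-witnesses {G} (proj₁ ∘ class) injective w hit
    where
    injective : Injective _≡_ _≡_ (progression {q} a e)
    injective = progression-injective {a = a} e≢0

  progression-closed : ∀ {n k a e} →
    (∀ i → + n ∣ˢ + length (i ∷ nb i) * a + + sumℕ (map (toℕ ∘ proj₁) (i ∷ nb i)) * e - k) →
    Closed G n k (progression a e ∘ proj₁ ∘ class)
  progression-closed {n} {k} {a} {e} per-class v =
    ∣⇒∣ᵤ (subst (λ z → + n ∣ˢ z - k) (sym sum≡) (per-class (class v)))
    where
    sum≡ : closedSum G (progression a e ∘ proj₁ ∘ class) v ≡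
           + length (class v ∷ nb (class v)) * a + + sumℕ (map (toℕ ∘ proj₁) (class v ∷ nb (class v))) * e
    sum≡ = trans (closedSum-via-cover (progression a e ∘ proj₁) v)
                 (sum-progression a e proj₁ (class v ∷ nb (class v)))

  congruent-labelling : ∀ {n k a} → 0 < n → Separates proj₁ →
                        (w : Vec (V G) q) → (∀ d → proj₁ (class (lookup w d)) ≡ d) →
                        (∀ i → + n ∣ˢ + length (i ∷ nb i) * a - k) →
                        ∃[ ℓ ] (ProperClosed G n k ℓ × HasOrder G ℓ q)
  congruent-labelling {n} {k} {a} n>0 separates w hit n∣|N|a-k =
    ℓ , (proj₁ proper×order , closed) , proj₂ proper×order
    where
    ℓ : V G → ℤ
    ℓ = progression a (+ n) ∘ proj₁ ∘ class
    proper×order : Proper G ℓ × HasOrder G ℓ q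
    proper×order = progression-labelling {a} (+n≢0 n>0) separates w hit
    closed : Closed G n k ℓ
    closed = progression-closed {n} {k} {a} {+ n} λ i →
      ∣-add-multiple {n} {+ length (i ∷ nb i) * a} {k}
        (+ sumℕ (map (toℕ ∘ proj₁) (i ∷ nb i))) (n∣|N|a-k i)

module _ {G : Graph} {q r : ℕ} (cover : Cover G q (suc r)) where
  open Cover cover

  PerfectCode : Set
  PerfectCode = ∀ i → length (filter in-code? (i ∷ nb i)) ≡ 1

  perfect? : ∀ i → Dec (length (filter in-code? (i ∷ nb i)) ≡ 1)
  perfect? i = length (filter in-code? (i ∷ nb i)) ℕ.≟ 1

  special-labelling : ∀ {n k} → 0 < n → (∀ t → k ≢ t * + n) →
                      Separates cover special-code → PerfectCode →
                      (w : Vec (V G) (suc q)) → (∀ d → special-code (class (lookup w d)) ≡ d) →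
                      ∃[ ℓ ] (ProperClosed G n k ℓ × HasOrder G ℓ (suc q))
  special-labelling {n} {k} n>0 k≢tn separates perfect w hit =
    f ∘ class , (proper-via-cover cover special-code injective separates , closed) ,
    hasOrder-by-witnesses {G} (special-code ∘ class) injective w hit
    where
    f : Fin q × Fin (suc r) → ℤ
    f = with-special k (+ n) ∘ special-code
    injective : Injective _≡_ _≡_ (with-special {q} k (+ n))
    injective = with-special-injective (+n≢0 n>0) (λ i → k≢tn (+ toℕ i))
    closed : Closed G n k (f ∘ class)
    closed v = ∣⇒∣ᵤ (subst (+ n ∣ˢ_) (cong₂ _-_ (sym (closedSum-via-cover cover f v)) exactly-k)
                                    (sum-with-special k (class v ∷ nb (class v))))
      where
      exactly-k : + length (filter in-code? (class v ∷ nb (class v))) * k ≡ k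
      exactly-k = trans (cong (λ c → + c * k) (perfect (class v))) (ℤ.*-identityˡ k)

-- The lattices

origin : Pt
origin = + 0 , + 0

form : ℕ → Pt → ℤ
form a (x , y) = x + + a * y

module _ {m : ℕ} (a : ℕ) (x y : ℤ) where
  private
    c : Fin (suc m)
    c = orbit (form a (x , y))

    right : ∀ A x y → x + + 1 + A * y ≡ x + A * y + + 1
    right = solve-∀
    left : ∀ A x y → x - + 1 + A * y ≡ x + A * y - + 1
    left = solve-∀
    up : ∀ A x y → x + A * (y + + 1) ≡ x + A * y + A
    up = solve-∀
    down : ∀ A x y → x + A * (y - + 1) ≡ x + A * y - A
    down = solve-∀

  orbit-right : orbit {m} (form a (x + + 1 , y)) ≡ c ↻ 1
  orbit-right = trans (cong orbit (right (+ a) x y)) (orbit-+ (form a (x , y)) 1)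

  orbit-left : orbit {m} (form a (x - + 1 , y)) ≡ c ↺ 1
  orbit-left = trans (cong orbit (left (+ a) x y)) (orbit-∸ (form a (x , y)) 1)

  orbit-up : orbit {m} (form a (x , y + + 1)) ≡ c ↻ a
  orbit-up = trans (cong orbit (up (+ a) x y)) (orbit-+ (form a (x , y)) a)

  orbit-down : orbit {m} (form a (x , y - + 1)) ≡ c ↺ a
  orbit-down = trans (cong orbit (down (+ a) x y)) (orbit-∸ (form a (x , y)) a)

module _ {m : ℕ} (b : ℕ) (x y : ℤ) where
  private
    c : Fin (suc m)
    c = orbit (form (suc b) (x , y))

    right-down : ∀ B x y → x + + 1 + (+ 1 + B) * (y - + 1) ≡ x + (+ 1 + B) * y - B
    right-down = solve-∀
    left-up : ∀ B x y → x - + 1 + (+ 1 + B) * (y + + 1) ≡ x + (+ 1 + B) * y + B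
    left-up = solve-∀

  orbit-right-down : orbit {m} (form (suc b) (x + + 1 , y - + 1)) ≡ c ↺ b
  orbit-right-down = trans (cong orbit (right-down (+ b) x y)) (orbit-∸ (form (suc b) (x , y)) b)

  orbit-left-up : orbit {m} (form (suc b) (x - + 1 , y + + 1)) ≡ c ↻ b
  orbit-left-up = trans (cong orbit (left-up (+ b) x y)) (orbit-+ (form (suc b) (x , y)) b)

-- Colours: x + y mod 2 on R4 and R6, x + 2y mod 3 on R3 (every edge changes
-- the form by a unit). Perfect codes: x + 3y ≡ 0 mod 5 on R4, x + 5y ≡ 0 mod 7
-- on R3 and x + 2y ≡ 0 mod 4 on R6, because along the closed neighbourhood the
-- form takes the values 0, ±1, ±3, resp. 0, ±1, ±4, ±5, resp. 0, ±1, 2.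
R4-cover : Cover R4 2 5
R4-cover = record
  { class      = λ v → orbit (form 1 v) , orbit (form 3 v)
  ; nb         = λ { (p , c) → (p ↻ 1 , c ↻ 1) ∷ (p ↺ 1 , c ↺ 1)
                             ∷ (p ↻ 1 , c ↻ 3) ∷ (p ↺ 1 , c ↺ 3) ∷ [] }
  ; class-nbrs = λ { (x , y) → Pointwise-≡⇒≡
      ( cong₂ _,_ (orbit-right 1 x y) (orbit-right 3 x y)
      ∷ cong₂ _,_ (orbit-left 1 x y)  (orbit-left 3 x y)
      ∷ cong₂ _,_ (orbit-up 1 x y)    (orbit-up 3 x y)
      ∷ cong₂ _,_ (orbit-down 1 x y)  (orbit-down 3 x y)
      ∷ []) }
  }

R3-cover : Cover R3 3 7
R3-cover = record
  { class      = λ v → orbit (form 2 v) , orbit (form 5 v)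
  ; nb         = λ { (p , c) → (p ↻ 1 , c ↻ 1) ∷ (p ↺ 1 , c ↺ 1)
                             ∷ (p ↻ 2 , c ↻ 5) ∷ (p ↺ 2 , c ↺ 5)
                             ∷ (p ↺ 1 , c ↺ 4) ∷ (p ↻ 1 , c ↻ 4) ∷ [] }
  ; class-nbrs = λ { (x , y) → Pointwise-≡⇒≡
      ( cong₂ _,_ (orbit-right 2 x y)      (orbit-right 5 x y)
      ∷ cong₂ _,_ (orbit-left 2 x y)       (orbit-left 5 x y)
      ∷ cong₂ _,_ (orbit-up 2 x y)         (orbit-up 5 x y)
      ∷ cong₂ _,_ (orbit-down 2 x y)       (orbit-down 5 x y)
      ∷ cong₂ _,_ (orbit-right-down 1 x y) (orbit-right-down 4 x y)
      ∷ cong₂ _,_ (orbit-left-up 1 x y)    (orbit-left-up 4 x y)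
      ∷ []) }
  }

R6-class : Pt → Fin 2 × Fin 4
R6-class v = orbit (form 1 v) , orbit (form 2 v)

R6-vertical : Fin 2 × Fin 4 → Fin 2 × Fin 4
R6-vertical (p@zero    , c) = p ↻ 1 , c ↻ 2
R6-vertical (p@(suc _) , c) = p ↺ 1 , c ↺ 2

R6-class-vert : ∀ x y → R6-class (vert x y) ≡ R6-vertical (R6-class (x , y))
R6-class-vert x y
  with (x + y) ℤ.%ℕ 2 | orbit {1} (form 1 (x , y)) | parity | orbit-up {1} 1 x y | orbit-down {1} 1 x y
  where
  parity : (x + y) ℤ.%ℕ 2 ≡ toℕ (orbit {1} (form 1 (x , y)))
  parity = trans (cong (λ z → (x + z) ℤ.%ℕ 2) (sym (ℤ.*-identityˡ y))) (%ℕ2≡orbit (form 1 (x , y)))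
... | zero  | zero     | _  | up | _    = cong₂ _,_ up (orbit-up 2 x y)
... | suc _ | suc zero | _  | _  | down = cong₂ _,_ down (orbit-down 2 x y)

R6-cover : Cover R6 2 4
R6-cover = record
  { class      = R6-class
  ; nb         = λ { (p , c) → (p ↻ 1 , c ↻ 1) ∷ (p ↺ 1 , c ↺ 1) ∷ R6-vertical (p , c) ∷ [] }
  ; class-nbrs = λ { (x , y) → Pointwise-≡⇒≡
      ( cong₂ _,_ (orbit-right 1 x y) (orbit-right 2 x y)
      ∷ cong₂ _,_ (orbit-left 1 x y)  (orbit-left 2 x y)
      ∷ R6-class-vert x y
      ∷ []) }
  }

-- Upper bounds

R4-upper : ∀ {n k} → 0 < n → ∃[ a ] + n ∣ˢ + 5 * a - k →
           ∃[ ℓ ] (ProperClosed R4 n k ℓ × HasOrder R4 ℓ 2)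
R4-upper n>0 (a , n∣5a-k) = congruent-labelling R4-cover {a = a} n>0
  (all-classes (separates? R4-cover proj₁)) w (all-Fin (hits? R4-cover proj₁ w)) (λ _ → n∣5a-k)
  where
  w : Vec Pt 2
  w = origin ∷ (+ 1 , + 0) ∷ []

R4-upper-special : ∀ {n k} → 0 < n → (∀ t → k ≢ t * + n) →
                   ∃[ ℓ ] (ProperClosed R4 n k ℓ × HasOrder R4 ℓ 3)
R4-upper-special n>0 k≢tn = special-labelling R4-cover n>0 k≢tn
  (all-classes (separates? R4-cover special-code)) (all-classes (perfect? R4-cover))
  w (all-Fin (hits? R4-cover special-code w))
  where
  w : Vec Pt 3
  w = origin ∷ (+ 2 , + 0) ∷ (+ 1 , + 0) ∷ []

R3-upper : ∀ {n k} → 0 < n → ∃[ a ] + n ∣ˢ + 7 * a - k →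
           ∃[ ℓ ] (ProperClosed R3 n k ℓ × HasOrder R3 ℓ 3)
R3-upper n>0 (a , n∣7a-k) = congruent-labelling R3-cover {a = a} n>0
  (all-classes (separates? R3-cover proj₁)) w (all-Fin (hits? R3-cover proj₁ w)) (λ _ → n∣7a-k)
  where
  w : Vec Pt 3
  w = origin ∷ (+ 1 , + 0) ∷ (+ 2 , + 0) ∷ []

R3-upper-special : ∀ {n k} → 0 < n → (∀ t → k ≢ t * + n) →
                   ∃[ ℓ ] (ProperClosed R3 n k ℓ × HasOrder R3 ℓ 4)
R3-upper-special n>0 k≢tn = special-labelling R3-cover n>0 k≢tn
  (all-classes (separates? R3-cover special-code)) (all-classes (perfect? R3-cover))
  w (all-Fin (hits? R3-cover special-code w))
  where
  w : Vec Pt 4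
  w = origin ∷ (+ 3 , + 0) ∷ (+ 1 , + 0) ∷ (+ 2 , + 0) ∷ []

-- e = k - 4a unless that vanishes, in which case e = n.
R6-parameters : ∀ {n k} → 0 < n → + gcd 8 n ∣ + 2 * k →
                ∃[ a ] ∃[ e ] (e ≢ + 0 × + n ∣ˢ + 4 * a + e - k × + n ∣ˢ + 2 * e)
R6-parameters {n} {k} n>0 g∣2k with linear-congruence 8 n g∣2k
... | a , n∣8a-2k with k - + 4 * a ℤ.≟ + 0
...   | no k-4a≢0 = a , k - + 4 * a , k-4a≢0 , divides (+ 0) (cancel a k) ,
                    subst (+ n ∣ˢ_) (negate a k) (Signed.∣m⇒∣-m n∣8a-2k)
  where
  cancel : ∀ a k → + 4 * a + (k - + 4 * a) - k ≡ + 0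
  cancel = solve-∀
  negate : ∀ a k → - (+ 8 * a - + 2 * k) ≡ + 2 * (k - + 4 * a)
  negate = solve-∀
...   | yes k-4a≡0 = a , + n , +n≢0 n>0 , subst (+ n ∣ˢ_) n≡4a+n-k Signed.∣-refl ,
                     ∣n⇒∣m*n (+ 2) Signed.∣-refl
  where
  regroup : ∀ a n k → + 4 * a + n - k ≡ n - (k - + 4 * a)
  regroup = solve-∀
  n≡4a+n-k : + n ≡ + 4 * a + + n - k
  n≡4a+n-k = sym (trans (regroup a (+ n) k) (trans (cong (_-_ (+ n)) k-4a≡0) (ℤ.+-identityʳ (+ n))))

R6-upper : ∀ {n k} → ∃[ a ] ∃[ e ] (e ≢ + 0 × + n ∣ˢ + 4 * a + e - k × + n ∣ˢ + 2 * e) →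
           ∃[ ℓ ] (ProperClosed R6 n k ℓ × HasOrder R6 ℓ 2)
R6-upper {n} {k} (a , e , e≢0 , n∣4a+e-k , n∣2e) =
  ℓ , (proj₁ proper×order , progression-closed R6-cover {n} {k} {a} {e} per-class) , proj₂ proper×order
  where
  open Cover R6-cover
  ℓ : Pt → ℤ
  ℓ = progression a e ∘ proj₁ ∘ class
  w : Vec Pt 2
  w = origin ∷ (+ 1 , + 0) ∷ []
  proper×order : Proper R6 ℓ × HasOrder R6 ℓ 2
  proper×order = progression-labelling R6-cover {a = a} e≢0
    (all-classes (separates? R6-cover proj₁)) w (all-Fin (hits? R6-cover proj₁ w))
  colour-sum : Fin 2 × Fin 4 → ℕ
  colour-sum i = sumℕ (map (toℕ ∘ proj₁) (i ∷ nb i))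
  one-or-three : ∀ t → t ≡ 1 ⊎ t ≡ 3 → + n ∣ˢ + 4 * a + + t * e - k
  one-or-three _ (inj₁ refl) = subst (λ z → + n ∣ˢ + 4 * a + z - k) (sym (ℤ.*-identityˡ e)) n∣4a+e-k
  one-or-three _ (inj₂ refl) = subst (+ n ∣ˢ_) (regroup a e k) (∣m∣n⇒∣m+n n∣4a+e-k n∣2e)
    where
    regroup : ∀ a e k → + 4 * a + e - k + + 2 * e ≡ + 4 * a + + 3 * e - k
    regroup = solve-∀
  per-class : ∀ i → + n ∣ˢ + 4 * a + + colour-sum i * e - k
  per-class i = one-or-three (colour-sum i)
    (all-classes (λ i → (colour-sum i ℕ.≟ 1) ⊎-dec (colour-sum i ℕ.≟ 3)) i)

R6-upper-special : ∀ {n k} → 0 < n → (∀ t → k ≢ t * + n) →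
                   ∃[ ℓ ] (ProperClosed R6 n k ℓ × HasOrder R6 ℓ 3)
R6-upper-special n>0 k≢tn = special-labelling R6-cover n>0 k≢tn
  (all-classes (separates? R6-cover special-code)) (all-classes (perfect? R6-cover))
  w (all-Fin (hits? R6-cover special-code w))
  where
  w : Vec Pt 3
  w = origin ∷ (+ 2 , + 0) ∷ (+ 1 , + 0) ∷ []

-- Lower bounds

order-2-sums : ∀ {G n k ℓ} → ProperClosed G n k ℓ → HasOrder G ℓ 2 → ∀ {u v} → v ∈ nbrs G u →
               + n ∣ˢ ℓ u + + length (nbrs G u) * ℓ v - k
order-2-sums {n = n} {k} (proper , closed) order {u} uv =
  subst (λ z → + n ∣ˢ z - k) (closedSum-order-2 proper order uv) (∣ᵤ⇒∣ (closed u))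

R4-order-2⇒gcd5∣k : ∀ {n k ℓ} → ProperClosed R4 n k ℓ → HasOrder R4 ℓ 2 → + gcd 5 n ∣ k
R4-order-2⇒gcd5∣k {n} {k} {ℓ} pc order =
  gcd∣combination 5 n (+ 2 * B - A) (∣m∣n⇒∣m+n (∣n⇒∣m*n (- + 3) sum₀) (∣n⇒∣m*n (+ 2) sum₁))
    (identity k A B)
  where
  A B : ℤ
  A = ℓ origin
  B = ℓ (+ 1 , + 0)
  sum₀ : + n ∣ˢ A + + 4 * B - k
  sum₀ = order-2-sums pc order {origin} (here refl)
  sum₁ : + n ∣ˢ B + + 4 * A - k
  sum₁ = order-2-sums pc order {+ 1 , + 0} (there (here refl))
  identity : ∀ k A B → k ≡ + 5 * (+ 2 * B - A) + (- + 3 * (A + + 4 * B - k) + + 2 * (B + + 4 * A - k))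
  identity = solve-∀

R6-order-2⇒gcd8∣2k : ∀ {n k ℓ} → ProperClosed R6 n k ℓ → HasOrder R6 ℓ 2 → + gcd 8 n ∣ + 2 * k
R6-order-2⇒gcd8∣2k {n} {k} {ℓ} pc order =
  gcd∣combination 8 n A (∣m∣n⇒∣m+n sum₀ (∣n⇒∣m*n (- + 3) sum₁)) (identity k A B)
  where
  A B : ℤ
  A = ℓ origin
  B = ℓ (+ 1 , + 0)
  sum₀ : + n ∣ˢ A + + 3 * B - k
  sum₀ = order-2-sums pc order {origin} (here refl)
  sum₁ : + n ∣ˢ B + + 3 * A - k
  sum₁ = order-2-sums pc order {+ 1 , + 0} (there (here refl))
  identity : ∀ k A B → + 2 * k ≡ + 8 * A + ((A + + 3 * B - k) + - + 3 * (B + + 3 * A - k))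
  identity = solve-∀

R3-adjacent : ∀ u {w} → {True (w ∈? nbrs R3 u)} → w ∈ nbrs R3 u
R3-adjacent u {w} {t} = toWitness t

-- With three labels every triangle is rainbow, so starting from the triangle
-- origin, r, s the labels around these three vertices are forced one triangle
-- at a time.
module _ {ℓ : Pt → ℤ} (proper : Proper R3 ℓ) (order : HasOrder R3 ℓ 3) where
  private
    r s : Pt
    r = + 1 , + 0
    s = + 0 , + 1

    A B C : ℤ
    A = ℓ origin
    B = ℓ r
    C = ℓ s

    apart : ∀ u {w X} → {True (w ∈? nbrs R3 u)} → ℓ u ≡ X → ℓ w ≢ X
    apart u {w} {_} {t} refl = proper u w (toWitness t) ∘ sym

    among : ∀ v → ∃[ i ] ℓ v ≡ ℓ (lookup (origin ∷ r ∷ s ∷ []) i)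
    among = label-among {R3} {ℓ} order (lookup (origin ∷ r ∷ s ∷ []))
      (unique-labels {R3} {ℓ} (origin ∷ r ∷ s ∷ [])
        ( (proper origin r (R3-adjacent origin) ∷ proper origin s (R3-adjacent origin) ∷ [])
        ∷ (proper r s (R3-adjacent r) ∷ []) ∷ [] ∷ []))

    is-A : ∀ {v} → ℓ v ≢ B → ℓ v ≢ C → ℓ v ≡ A
    is-A {v} ≢B ≢C with among v
    ... | zero             , eq = eq
    ... | suc zero         , eq = contradiction eq ≢B
    ... | suc (suc zero)   , eq = contradiction eq ≢C

    is-B : ∀ {v} → ℓ v ≢ A → ℓ v ≢ C → ℓ v ≡ B
    is-B {v} ≢A ≢C with among v
    ... | zero             , eq = contradiction eq ≢A
    ... | suc zero         , eq = eq
    ... | suc (suc zero)   , eq = contradiction eq ≢C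

    is-C : ∀ {v} → ℓ v ≢ A → ℓ v ≢ B → ℓ v ≡ C
    is-C {v} ≢A ≢B with among v
    ... | zero             , eq = contradiction eq ≢A
    ... | suc zero         , eq = contradiction eq ≢B
    ... | suc (suc zero)   , eq = eq

    ℓ[1,-1] : ℓ (+ 1 , -1ℤ) ≡ C
    ℓ[1,-1] = is-C (apart origin refl) (apart r refl)
    ℓ[0,-1] : ℓ (+ 0 , -1ℤ) ≡ B
    ℓ[0,-1] = is-B (apart origin refl) (apart (+ 1 , -1ℤ) ℓ[1,-1])
    ℓ[-1,0] : ℓ (-1ℤ , + 0) ≡ C
    ℓ[-1,0] = is-C (apart origin refl) (apart (+ 0 , -1ℤ) ℓ[0,-1])
    ℓ[-1,1] : ℓ (-1ℤ , + 1) ≡ B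
    ℓ[-1,1] = is-B (apart origin refl) (apart s refl)
    ℓ[1,1] : ℓ (+ 1 , + 1) ≡ A
    ℓ[1,1] = is-A (apart r refl) (apart s refl)
    ℓ[2,-1] : ℓ (+ 2 , -1ℤ) ≡ A
    ℓ[2,-1] = is-A (apart r refl) (apart (+ 1 , -1ℤ) ℓ[1,-1])
    ℓ[2,0] : ℓ (+ 2 , + 0) ≡ C
    ℓ[2,0] = is-C (apart (+ 2 , -1ℤ) ℓ[2,-1]) (apart r refl)
    ℓ[0,2] : ℓ (+ 0 , + 2) ≡ B
    ℓ[0,2] = is-B (apart (+ 1 , + 1) ℓ[1,1]) (apart s refl)
    ℓ[-1,2] : ℓ (-1ℤ , + 2) ≡ A
    ℓ[-1,2] = is-A (apart (-1ℤ , + 1) ℓ[-1,1]) (apart s refl)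

  R3-order-3⇒gcd7∣k : ∀ {n k} → Closed R3 n k ℓ → + gcd 7 n ∣ k
  R3-order-3⇒gcd7∣k {n} {k} closed =
    gcd∣combination 7 n (+ 5 * (A + B + C) - + 2 * k)
      (∣n⇒∣m*n (- + 5) (∣m∣n⇒∣m+n (∣m∣n⇒∣m+n at-origin at-r) at-s)) (identity k A B C)
    where
    at : ∀ v {xs} → map ℓ (nbrs R3 v) ≡ xs → + n ∣ˢ ℓ v + sumℤ xs - k
    at v {xs} eq = subst (λ ys → + n ∣ˢ ℓ v + sumℤ ys - k) eq (∣ᵤ⇒∣ (closed v))
    at-origin : + n ∣ˢ A + sumℤ (B ∷ C ∷ C ∷ B ∷ C ∷ B ∷ []) - k
    at-origin = at origin (Pointwise-≡⇒≡ (refl ∷ ℓ[-1,0] ∷ refl ∷ ℓ[0,-1] ∷ ℓ[1,-1] ∷ ℓ[-1,1] ∷ []))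
    at-r : + n ∣ˢ B + sumℤ (C ∷ A ∷ A ∷ C ∷ A ∷ C ∷ []) - k
    at-r = at r (Pointwise-≡⇒≡ (ℓ[2,0] ∷ refl ∷ ℓ[1,1] ∷ ℓ[1,-1] ∷ ℓ[2,-1] ∷ refl ∷ []))
    at-s : + n ∣ˢ C + sumℤ (A ∷ B ∷ B ∷ A ∷ B ∷ A ∷ []) - k
    at-s = at s (Pointwise-≡⇒≡ (ℓ[1,1] ∷ ℓ[-1,1] ∷ ℓ[0,2] ∷ refl ∷ refl ∷ ℓ[-1,2] ∷ []))
    identity : ∀ k A B C →
      k ≡ + 7 * (+ 5 * (A + B + C) - + 2 * k) +
          - + 5 * ((A + (B + (C + (C + (B + (C + (B + + 0)))))) - k) +
                   (B + (C + (A + (A + (C + (A + (C + + 0)))))) - k) +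
                   (C + (A + (B + (B + (A + (B + (A + + 0)))))) - k))
    identity = solve-∀

R3-lower : ∀ {n k} ℓ j → ProperClosed R3 n k ℓ → HasOrder R3 ℓ j → 3 ≤ j
R3-lower ℓ j (proper , _) =
  triangle⇒3≤order proper
    (R3-adjacent origin {+ 1 , + 0}) (R3-adjacent origin {+ 0 , + 1}) (R3-adjacent (+ 1 , + 0))

R3-lower-special : ∀ {n k} → ¬ (+ gcd 7 n ∣ k) →
                   ∀ ℓ j → ProperClosed R3 n k ℓ → HasOrder R3 ℓ j → 4 ≤ j
R3-lower-special ¬g∣k ℓ j pc@(proper , closed) order =
  order-step {R3} {ℓ} (R3-lower ℓ j pc order)
    (λ order₃ → ¬g∣k (R3-order-3⇒gcd7∣k proper order₃ closed)) order

R4-lower : ∀ {n k} ℓ j → ProperClosed R4 n k ℓ → HasOrder R4 ℓ j → 2 ≤ j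
R4-lower ℓ j (proper , _) = edge⇒2≤order proper {origin} (here refl)

R4-lower-special : ∀ {n k} → ¬ (+ gcd 5 n ∣ k) →
                   ∀ ℓ j → ProperClosed R4 n k ℓ → HasOrder R4 ℓ j → 3 ≤ j
R4-lower-special ¬g∣k ℓ j pc order =
  order-step {R4} {ℓ} (R4-lower ℓ j pc order) (¬g∣k ∘ R4-order-2⇒gcd5∣k pc) order

R6-lower : ∀ {n k} ℓ j → ProperClosed R6 n k ℓ → HasOrder R6 ℓ j → 2 ≤ j
R6-lower ℓ j (proper , _) = edge⇒2≤order proper {origin} (here refl)

R6-lower-special : ∀ {n k} → ¬ (+ gcd 8 n ∣ + 2 * k) →
                   ∀ ℓ j → ProperClosed R6 n k ℓ → HasOrder R6 ℓ j → 3 ≤ j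
R6-lower-special ¬g∣2k ℓ j pc order =
  order-step {R6} {ℓ} (R6-lower ℓ j pc order) (¬g∣2k ∘ R6-order-2⇒gcd8∣2k pc) order

theorem5p3 : (k : ℤ) (n : ℕ) → 0 < n →
    ((+ gcd 7 n ∣ k → ChiEq R3 n k 3) × (¬ (+ gcd 7 n ∣ k) → ChiEq R3 n k 4)) ×
    ((+ gcd 5 n ∣ k → ChiEq R4 n k 2) × (¬ (+ gcd 5 n ∣ k) → ChiEq R4 n k 3)) ×
    ((+ gcd 8 n ∣ + 2 * k → ChiEq R6 n k 2) × (¬ (+ gcd 8 n ∣ + 2 * k) → ChiEq R6 n k 3))
theorem5p3 k n n>0 =
  ( (λ g∣k  → R3-upper n>0 (linear-congruence 7 n g∣k) , R3-lower)
  , (λ ¬g∣k → R3-upper-special n>0 (not-multiple 7 n ¬g∣k) , R3-lower-special ¬g∣k) ) ,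
  ( (λ g∣k  → R4-upper n>0 (linear-congruence 5 n g∣k) , R4-lower)
  , (λ ¬g∣k → R4-upper-special n>0 (not-multiple 5 n ¬g∣k) , R4-lower-special ¬g∣k) ) ,
  ( (λ g∣2k  → R6-upper (R6-parameters n>0 g∣2k) , R6-lower)
  , (λ ¬g∣2k → R6-upper-special n>0 (not-multiple 8 n (¬g∣2k ∘ double)) , R6-lower-special ¬g∣2k) )
  where
  double : + gcd 8 n ∣ k → + gcd 8 n ∣ + 2 * k
  double g∣k = ∣⇒∣ᵤ (∣n⇒∣m*n (+ 2) (∣ᵤ⇒∣ {+ gcd 8 n} {k} g∣k))
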